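{- Let $G$ be a graph with $n$ vertices and let $X$ be an array indexed by the subsets of $V(G)$, processed by the following procedure. Initialization: for each $S\subseteq V(G)$, set $X[S]=\chi(S)$ if $\chi(S)\le 3$ and $X[S]=\infty$ otherwise. Main loop: visit the subsets $S$ of $V(G)$ in an order in which every proper subset of a set is visited before the set itself; when $S$ is visited and $3\le X[S]<\infty$, then for each independent set $I$ of $G\setminus S$ produced by a procedure that lists (at least) all maximal independent sets $I$ of $G\setminus S$ with $|I|\le |S|/X[S]$ (and possibly some other, non-maximal, independent sets of $G\setminus S$), set $X[S\cup I]=\min(X[S\cup I],X[S]+1)$. Then at every moment during this procedure, $X[S]\ge \chi(S)$ for every $S\subseteq V(G)$.
   Context: For $S\subseteq V(G)$, $\chi(S)$ denotes the chromatic number of the subgraph of $G$ induced by $S$ (the minimum number of colors in a coloring of $S$ in which adjacent vertices receive different colors). An independent set is a set of pairwise nonadjacent vertices; it is maximal in $G\setminus S$ if it is not properly contained in another independent subset of $V(G)\setminus S$. -}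

module Defs where

open import Data.Nat using (ℕ; zero; suc; _≤_; _<_; _*_)
open import Data.Nat.Base using (_⊓_)
open import Data.Fin using (Fin)
open import Data.Fin.Subset using (Subset; _∈_; _∉_; _⊆_; _⊂_; _∪_; ∁; ∣_∣)
open import Data.Bool using (Bool; if_then_else_)
open import Data.Bool.Properties using () renaming (_≟_ to _≟ᵇ_)
open import Data.Vec.Properties using (≡-dec)
open import Data.List using (List; []; _∷_; _++_)
open import Data.List.Relation.Unary.Unique.Propositional using (Unique)
import Data.List.Membership.Propositional as LM
open import Data.Product using (Σ; ∃; _×_; _,_)
open import Relation.Nullary using (¬_; does)
open import Relation.Binary.PropositionalEquality using (_≡_; _≢_)

record Graph (n : ℕ) : Set₁ where
  field
    Adj   : Fin n → Fin n → Set
    sym   : ∀ {u v} → Adj u v → Adj v u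
    irrefl : ∀ {u} → ¬ Adj u u
open Graph public

module _ {n : ℕ} (G : Graph n) where

  Colorable : Subset n → ℕ → Set
  Colorable S k = Σ (Fin n → Fin k) λ c →
    ∀ u v → u ∈ S → v ∈ S → Adj G u v → c u ≢ c v

  IsChromaticNumber : Subset n → ℕ → Set
  IsChromaticNumber S k = Colorable S k × (∀ j → Colorable S j → k ≤ j)

  Independent : Subset n → Set
  Independent I = ∀ u v → u ∈ I → v ∈ I → ¬ Adj G u v

  IndependentOutside : Subset n → Subset n → Set
  IndependentOutside S I = Independent I × I ⊆ ∁ S

  MaximalIndependentOutside : Subset n → Subset n → Set
  MaximalIndependentOutside S I = IndependentOutside S I ×
    (∀ J → IndependentOutside S J → I ⊆ J → J ≡ I)

data ℕ∞ : Set where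
  fin : ℕ → ℕ∞
  ∞   : ℕ∞

data _≤∞_ : ℕ∞ → ℕ∞ → Set where
  fin≤fin : ∀ {m k} → m ≤ k → fin m ≤∞ fin k
  _≤∞∞    : ∀ x → x ≤∞ ∞

min∞ : ℕ∞ → ℕ∞ → ℕ∞
min∞ (fin a) (fin b) = fin (a ⊓ b)
min∞ (fin a) ∞       = fin a
min∞ ∞       y       = y

Array : ℕ → Set
Array n = Subset n → ℕ∞

module _ {n : ℕ} where
  open LM using () renaming (_∈_ to _∈ₗ_)

  update : Subset n → ℕ → Subset n → Array n → Array n
  update S k I X T =
    if does (≡-dec _≟ᵇ_ T (S ∪ I)) then min∞ (X T) (fin (suc k)) else X T

  ValidOrder : List (Subset n) → Set
  ValidOrder ord = Unique ord × (∀ S → S ∈ₗ ord) ×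
    (∀ xs S ys T → ord ≡ xs ++ (S ∷ ys) → T ⊂ S → T ∈ₗ xs)

  -- the output of the enumeration procedure for S with X[S] = k:
  -- only independent sets of G \ S, and at least every maximal
  -- independent set I of G \ S with |I| ≤ |S| / k  (i.e. |I| * k ≤ |S|)
  ValidEnumeration : Graph n → Subset n → ℕ → List (Subset n) → Set
  ValidEnumeration G S k Is =
    (∀ I → I ∈ₗ Is → IndependentOutside G S I) ×
    (∀ I → MaximalIndependentOutside G S I → ∣ I ∣ * k ≤ ∣ S ∣ → I ∈ₗ Is)

  Initial : Graph n → Array n → Set
  Initial G X = ∀ S k → IsChromaticNumber G S k →
    (k ≤ 3 → X S ≡ fin k) × (3 < k → X S ≡ ∞)

  Active : Array n → Subset n → Set
  Active X S = ∃ λ k → X S ≡ fin k × 3 ≤ k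

  -- control state: between visits, or inside the visit of S (with k = X[S]
  -- read at the start of the visit) with the remaining sets I to process
  data Phase : Set where
    idle : Phase
    busy : Subset n → ℕ → List (Subset n) → Phase

  -- Reach G ord todo ph X : at some moment of the procedure (with visiting
  -- order ord), the sets still to be visited are todo, the control state
  -- is ph and the array is X.  All choices (enumeration outputs) are
  -- arbitrary subject to ValidEnumeration.
  data Reach (G : Graph n) (ord : List (Subset n)) :
         List (Subset n) → Phase → Array n → Set where
    start  : ∀ {X} → Initial G X → Reach G ord ord idle X
    skip   : ∀ {S rest X} → Reach G ord (S ∷ rest) idle X → ¬ Active X S →
             Reach G ord rest idle X
    enter  : ∀ {S rest X k Is} → Reach G ord (S ∷ rest) idle X →
             X S ≡ fin k → 3 ≤ k → ValidEnumeration G S k Is →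
             Reach G ord rest (busy S k Is) X
    step   : ∀ {todo S k I Is X} → Reach G ord todo (busy S k (I ∷ Is)) X →
             Reach G ord todo (busy S k Is) (update S k I X)
    finish : ∀ {todo S k X} → Reach G ord todo (busy S k []) X →
             Reach G ord todo idle X

{-# OPTIONS --safe #-}
-- Every finite value X[S] is witnessed by a proper colouring of S with X[S] colours: initially
-- X[S] = χ(S), and an update X[S ∪ I] := X[S] + 1 colours the independent set I with one fresh
-- colour. Since χ(S) is below the number of colours of any colouring, X[S] ≥ χ(S) throughout.
module Submission where

open import Defs hiding (sym)
open import Data.Nat using (ℕ; suc; _≤_; _<_; _≤?_)
open import Data.Nat.Properties using (⊓-sel; ≮⇒≥; ≰⇒>)
open import Data.Nat.Induction using (<-rec)
open import Data.Fin using (Fin; fromℕ; inject₁)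
open import Data.Fin.Properties using (fromℕ≢inject₁; inject₁-injective)
open import Data.Fin.Subset using (Subset; _∈_; _∉_; _∪_)
open import Data.Fin.Subset.Properties using (_∈?_; x∈p∪q⁻)
open import Data.List using (List)
open import Data.List.Relation.Unary.All using (All; _∷_; tabulate)
open import Data.Product using (∃; _×_; _,_; proj₁; proj₂)
open import Data.Sum using (_⊎_; inj₁; inj₂)
open import Data.Unit using (⊤; tt)
open import Data.Vec.Properties using (≡-dec)
open import Data.Bool.Properties using () renaming (_≟_ to _≟ᵇ_)
open import Level using (0ℓ)
open import Effect.Monad using (RawMonad)
open import Relation.Nullary using (¬_; yes; no)
open import Relation.Nullary.Decidable using (decidable-stable; ¬¬-excluded-middle)
open import Relation.Nullary.Negation using (¬¬-Monad; ¬¬-map; contradiction)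
open import Relation.Binary.PropositionalEquality using (_≡_; _≢_; refl; sym; trans; subst; cong)

open RawMonad (¬¬-Monad {0ℓ})

¬¬-least : ∀ {P : ℕ → Set} j → P j → ¬ ¬ ∃ λ k → P k × (∀ i → P i → k ≤ i)
¬¬-least {P} = <-rec (λ j → P j → ¬ ¬ ∃ λ k → P k × (∀ i → P i → k ≤ i)) λ j rec pj → do
  yes (i , i<j , pi) ← ¬¬-excluded-middle {A = ∃ λ i → i < j × P i}
    where no none → pure (j , pj , λ i pi → ≮⇒≥ λ i<j → none (i , i<j , pi))
  rec i<j pi

fin-injective : ∀ {a b} → fin a ≡ fin b → a ≡ b
fin-injective refl = refl

min∞-fin-sel : ∀ x k {m} → min∞ x (fin k) ≡ fin m → x ≡ fin m ⊎ m ≡ k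
min∞-fin-sel (fin a) k refl with ⊓-sel a k
... | inj₁ a⊓k≡a = inj₁ (cong fin (sym a⊓k≡a))
... | inj₂ a⊓k≡k = inj₂ a⊓k≡k
min∞-fin-sel ∞ k refl = inj₂ refl

module _ {n : ℕ} (G : Graph n) where

  colorable-id : ∀ S → Colorable G S n
  colorable-id S = (λ u → u) , λ u v _ _ uv u≡v → irrefl G (subst (Adj G u) (sym u≡v) uv)

  ¬¬-chromaticNumber : ∀ S → ¬ ¬ ∃ (IsChromaticNumber G S)
  ¬¬-chromaticNumber S = ¬¬-least n (colorable-id S)

  colorable-∪-independent : ∀ {S I k} → Colorable G S k → Independent G I →
                            Colorable G (S ∪ I) (suc k)
  colorable-∪-independent {S} {I} {k} (c , proper) indep = c′ , proper′
    where
    c′ : Fin n → Fin (suc k)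
    c′ u with u ∈? I
    ... | yes _ = fromℕ k
    ... | no _  = inject₁ (c u)

    ∈S : ∀ {w} → w ∈ S ∪ I → w ∉ I → w ∈ S
    ∈S {w} w∈S∪I w∉I with x∈p∪q⁻ S I w∈S∪I
    ... | inj₁ w∈S = w∈S
    ... | inj₂ w∈I = contradiction w∈I w∉I

    proper′ : ∀ u v → u ∈ S ∪ I → v ∈ S ∪ I → Adj G u v → c′ u ≢ c′ v
    proper′ u v u∈ v∈ uv with u ∈? I | v ∈? I
    ... | yes u∈I | yes v∈I = λ _ → indep u v u∈I v∈I uv
    ... | yes _   | no _    = fromℕ≢inject₁
    ... | no _    | yes _   = λ eq → fromℕ≢inject₁ (sym eq)
    ... | no u∉I  | no v∉I  = λ eq → proper u v (∈S u∈ u∉I) (∈S v∈ v∉I) uv (inject₁-injective eq)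

  -- Stated under ¬ ¬ because χ(S) exists only classically: Adj is not assumed decidable.
  Sound : Array n → Set
  Sound X = ∀ S m → X S ≡ fin m → ¬ ¬ Colorable G S m

  SoundPhase : Phase → Set
  SoundPhase idle          = ⊤
  SoundPhase (busy S k Is) = ¬ ¬ Colorable G S k × All (Independent G) Is

  initial-colorable : ∀ {X S k m} → Initial G X → IsChromaticNumber G S k →
                      X S ≡ fin m → Colorable G S m
  initial-colorable {S = S} {k} {m} ini χ XS≡m with k ≤? 3
  ... | yes k≤3 = subst (Colorable G S) k≡m (proj₁ χ)
    where
    k≡m : k ≡ m
    k≡m = fin-injective (trans (sym (proj₁ (ini S k χ) k≤3)) XS≡m)
  ... | no k≰3 with () ← trans (sym XS≡m) (proj₂ (ini S k χ) (≰⇒> k≰3))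

  initial-sound : ∀ {X} → Initial G X → Sound X
  initial-sound ini S m XS≡m = ¬¬-map (λ (_ , χ) → initial-colorable ini χ XS≡m) (¬¬-chromaticNumber S)

  update-sound : ∀ {S k I X} → Sound X → ¬ ¬ Colorable G S k → Independent G I →
                 Sound (update S k I X)
  update-sound {S} {k} {I} {X} sound colS indep T m eq with ≡-dec _≟ᵇ_ T (S ∪ I)
  ... | no _ = sound T m eq
  ... | yes refl with min∞-fin-sel (X T) (suc k) eq
  ...   | inj₁ XT≡m = sound T m XT≡m
  ...   | inj₂ refl = ¬¬-map (λ c → colorable-∪-independent c indep) colS

  reach-sound : ∀ {ord todo ph X} → Reach G ord todo ph X → Sound X × SoundPhase ph
  reach-sound (start ini) = initial-sound ini , tt
  reach-sound (skip r _)  = proj₁ (reach-sound r) , tt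
  reach-sound (enter {S = S} {X = X} r XS≡k _ (indep , _)) =
    sound , sound S _ XS≡k , tabulate λ {I} I∈Is → proj₁ (indep I I∈Is)
    where
    sound : Sound X
    sound = proj₁ (reach-sound r)
  reach-sound (step r) with reach-sound r
  ... | sound , colS , indep ∷ indeps = update-sound sound colS indep , colS , indeps
  reach-sound (finish r) = proj₁ (reach-sound r) , tt

lemma3 : ∀ {n : ℕ} (G : Graph n) (ord : List (Subset n)) → ValidOrder ord →
    ∀ {todo : List (Subset n)} {ph : Phase} {X : Array n} →
    Reach G ord todo ph X →
    ∀ (S : Subset n) (k : ℕ) → IsChromaticNumber G S k → fin k ≤∞ X S
lemma3 G _ _ {X = X} r S k (_ , least) with X S in XS≡m
... | ∞     = _ ≤∞∞
... | fin m = fin≤fin (decidable-stable (k ≤? m) (¬¬-map (least m) (proj₁ (reach-sound G r) S m XS≡m)))
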